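{- Let $t \ge 1$ and $b \ge 0$ be integers, $T$ a finite non-empty subset of $\mathbb{Z}^b$, and $f : \mathbb{Z}^b \to \mathbb{Z}$ a function. Then there is a function $g : \mathbb{Z}^b \to \{0,\dots,t-1\}$ such that for each $x \in \mathbb{Z}^b$, $$\sum_{y \in T} g(x-y) \equiv f(x) \pmod t.$$
   Context: $\mathbb{Z}^0$ denotes the trivial group. -}

module Defs where

open import Data.Nat using (ℕ)
open import Data.Integer using (ℤ; +_; _-_; _+_)
open import Data.Integer.Divisibility using (_∣_)
open import Data.Fin using (Fin; toℕ)
open import Data.Vec using (Vec; zipWith)
open import Data.List using (List; map; foldr)

ℤ^ : ℕ → Set
ℤ^ b = Vec ℤ b

_⊖_ : ∀ {b} → ℤ^ b → ℤ^ b → ℤ^ b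
x ⊖ y = zipWith _-_ x y

sumℤ : List ℤ → ℤ
sumℤ = foldr _+_ (+ 0)

_≡_[mod_] : ℤ → ℤ → ℕ → Set
a ≡ c [mod t ] = (+ t) ∣ (a - c)

convSum : ∀ {b t} → (ℤ^ b → Fin t) → List (ℤ^ b) → ℤ^ b → ℤ
convSum g T x = sumℤ (map (λ y → + toℕ (g (x ⊖ y))) T)

module Submission where

-- Fix a homomorphism φ : ℤ^b → ℤ that is injective on T; here
-- φ(v) = v₀ + K v₁ + K² v₂ + … with K = 2B + 1 larger than twice every
-- coordinate of T.  Let y₁ and y₂ be the (unique) points of T of least and
-- greatest height and D = φ y₂ - φ y₁.  Define g on ℤ^b by recursion:
--   * on the window 0 ≤ φ z < D put g z = 0;
--   * for φ z ≥ D choose g z so that the congruence at x = z + y₁ holds; the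
--     other summands g(x - y) there have heights in [φ z - D, φ z);
--   * for φ z < 0 choose g z so that the congruence at x = z + y₂ holds; the
--     other summands have heights in (φ z, φ z + D].
-- Each choice only uses points closer to the window, so the recursion is
-- well founded (a guarded fixpoint, built by iteration).  Every x has either
-- φ(x - y₁) ≥ D or φ(x - y₂) < 0, so every congruence was imposed.

open import Defs
open import Data.Nat using (ℕ; _≥_)
open import Data.Integer using (ℤ)
open import Data.Fin using (Fin)
open import Data.List using (List; [])
open import Data.List.Relation.Unary.Unique.Propositional using (Unique)
open import Data.Product using (Σ)
open import Relation.Binary.PropositionalEquality using (_≢_)

import Data.Nat as ℕ
import Data.Nat.Properties as ℕₚ
open import Data.Nat using (zero; suc; z≤n; s≤s; _≤′_; ≤′-refl; ≤′-step)
open import Data.Nat.Divisibility using (divides)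
open import Data.Integer
  using (+_; -[1+_]; _+_; _-_; _*_; -_; ∣_∣; _≤_; _<_; +≤+; +<+; -<-)
import Data.Integer.Properties as ℤₚ
open import Data.Integer.DivMod using (_/ℕ_; _%ℕ_; n%ℕd<d; a≡a%ℕn+[a/ℕn]*n)
open import Data.Integer.Tactic.RingSolver using (solve-∀)
open import Data.Fin using (toℕ; fromℕ<)
open import Data.Fin.Properties using (toℕ-fromℕ<)
open import Data.Vec using ([]; _∷_; zipWith)
import Data.Vec.Relation.Unary.All as Vec
open import Data.List using (_∷_; _++_; map)
open import Data.Nat.ListAction using (sum)
open import Data.List.Relation.Unary.All as All using (All; []; _∷_)
open import Data.List.Relation.Unary.All.Properties using (++⁺; ++⁻)
open import Data.List.Relation.Unary.AllPairs using ([]; _∷_)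
open import Data.Product using (_,_; _×_; proj₁; proj₂)
open import Data.Empty using (⊥-elim)
open import Relation.Nullary using (¬_; yes; no)
open import Relation.Binary.PropositionalEquality
  using (_≡_; refl; sym; trans; cong; cong₂; subst; subst₂; module ≡-Reasoning)

+-cancelʳ-< : ∀ p {a c} → a + p < c + p → a < c
+-cancelʳ-< p {a} {c} lt = subst₂ _<_ (undo a p) (undo c p) (ℤₚ.+-monoˡ-< (- p) lt)
  where
  undo : ∀ x p → x + p - p ≡ x
  undo = solve-∀

+-cancelʳ-≤ : ∀ p {a c} → a + p ≤ c + p → a ≤ c
+-cancelʳ-≤ p {a} {c} le = subst₂ _≤_ (undo a p) (undo c p) (ℤₚ.+-monoˡ-≤ (- p) le)
  where
  undo : ∀ x p → x + p - p ≡ x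
  undo = solve-∀

_⊕_ : ∀ {b} → ℤ^ b → ℤ^ b → ℤ^ b
x ⊕ y = zipWith _+_ x y

⊖-⊕-cancel : ∀ {b} (x y : ℤ^ b) → (x ⊖ y) ⊕ y ≡ x
⊖-⊕-cancel [] [] = refl
⊖-⊕-cancel (a ∷ x) (c ∷ y) = cong₂ _∷_ (cancel a c) (⊖-⊕-cancel x y)
  where
  cancel : ∀ a c → a - c + c ≡ a
  cancel = solve-∀

height : ∀ {b} → ℕ → ℤ^ b → ℤ
height K [] = + 0
height K (a ∷ v) = a + + K * height K v

height-⊖ : ∀ K {b} (x y : ℤ^ b) → height K (x ⊖ y) ≡ height K x - height K y
height-⊖ K [] [] = refl
height-⊖ K (a ∷ x) (c ∷ y) = begin
  a - c + + K * height K (x ⊖ y)            ≡⟨ cong (λ u → a - c + + K * u) (height-⊖ K x y) ⟩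
  a - c + + K * (height K x - height K y)   ≡⟨ regroup (+ K) a c (height K x) (height K y) ⟩
  (a + + K * height K x) - (c + + K * height K y) ∎
  where
  open ≡-Reasoning
  regroup : ∀ k a c p q → a - c + k * (p - q) ≡ (a + k * p) - (c + k * q)
  regroup = solve-∀

height-⊕ : ∀ K {b} (x y : ℤ^ b) → height K (x ⊕ y) ≡ height K x + height K y
height-⊕ K [] [] = refl
height-⊕ K (a ∷ x) (c ∷ y) = begin
  a + c + + K * height K (x ⊕ y)            ≡⟨ cong (λ u → a + c + + K * u) (height-⊕ K x y) ⟩
  a + c + + K * (height K x + height K y)   ≡⟨ regroup (+ K) a c (height K x) (height K y) ⟩
  (a + + K * height K x) + (c + + K * height K y) ∎
  where
  open ≡-Reasoning
  regroup : ∀ k a c p q → a + c + k * (p + q) ≡ (a + k * p) + (c + k * q)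
  regroup = solve-∀

Bounded : ℕ → ∀ {b} → ℤ^ b → Set
Bounded B = Vec.All (λ a → ∣ a ∣ ℕ.≤ B)

-- Base-K digits are unique: a digit of absolute value ≤ B is determined
-- modulo K = 2B + 1, since two such digits differ by less than K.
digits-unique : ∀ B {a c p q} →
  a + + suc (B ℕ.+ B) * p ≡ c + + suc (B ℕ.+ B) * q →
  ∣ a ∣ ℕ.≤ B → ∣ c ∣ ℕ.≤ B → a ≡ c × p ≡ q
digits-unique B {a} {c} {p} {q} eq ∣a∣≤B ∣c∣≤B =
  ℤₚ.i-j≡0⇒i≡j a c a-c≡0 , sym (ℤₚ.i-j≡0⇒i≡j q p q-p≡0)
  where
  K = suc (B ℕ.+ B)
  open ≡-Reasoning
  gap : a - c ≡ + K * (q - p)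
  gap = begin
    a - c                                                ≡⟨ regroup a c p q (+ K) ⟩
    (a + + K * p) - (c + + K * q) + + K * (q - p)        ≡⟨ cong (λ u → u - (c + + K * q) + + K * (q - p)) eq ⟩
    (c + + K * q) - (c + + K * q) + + K * (q - p)        ≡⟨ cong (_+ + K * (q - p)) (ℤₚ.+-inverseʳ (c + + K * q)) ⟩
    + 0 + + K * (q - p)                                  ≡⟨ ℤₚ.+-identityˡ _ ⟩
    + K * (q - p)                                        ∎
    where
    regroup : ∀ a c p q k → a - c ≡ (a + k * p) - (c + k * q) + k * (q - p)
    regroup = solve-∀
  gap-small : K ℕ.* ∣ q - p ∣ ℕ.< K
  gap-small = subst (ℕ._< K) (trans (cong ∣_∣ gap) (ℤₚ.abs-* (+ K) (q - p)))
                (s≤s (ℕₚ.≤-trans (ℤₚ.∣i-j∣≤∣i∣+∣j∣ a c) (ℕₚ.+-mono-≤ ∣a∣≤B ∣c∣≤B)))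
  multiple-below : ∀ m → K ℕ.* m ℕ.< K → m ≡ 0
  multiple-below zero _ = refl
  multiple-below (suc m) lt = ⊥-elim (ℕₚ.<⇒≱ lt (ℕₚ.m≤m*n K (suc m)))
  q-p≡0 : q - p ≡ + 0
  q-p≡0 = ℤₚ.∣i∣≡0⇒i≡0 (multiple-below ∣ q - p ∣ gap-small)
  a-c≡0 : a - c ≡ + 0
  a-c≡0 = trans gap (trans (cong (+ K *_) q-p≡0) (ℤₚ.*-zeroʳ (+ K)))

height-injective : ∀ B {b} {x y : ℤ^ b} → Bounded B x → Bounded B y →
  height (suc (B ℕ.+ B)) x ≡ height (suc (B ℕ.+ B)) y → x ≡ y
height-injective B {x = []} {[]} _ _ _ = refl
height-injective B {x = a ∷ x} {c ∷ y} (∣a∣≤B Vec.∷ x-bd) (∣c∣≤B Vec.∷ y-bd) eq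
  with digits-unique B {a} {c} eq ∣a∣≤B ∣c∣≤B
... | refl , tails = cong (a ∷_) (height-injective B x-bd y-bd tails)

norm : ∀ {b} → ℤ^ b → ℕ
norm [] = 0
norm (a ∷ v) = ∣ a ∣ ℕ.+ norm v

bounded-weaken : ∀ {B B′ b} {v : ℤ^ b} → B ℕ.≤ B′ → Bounded B v → Bounded B′ v
bounded-weaken B≤B′ = Vec.map (λ h → ℕₚ.≤-trans h B≤B′)

norm-bounded : ∀ {b} (v : ℤ^ b) → Bounded (norm v) v
norm-bounded [] = Vec.[]
norm-bounded (a ∷ v) = ℕₚ.m≤m+n _ _ Vec.∷ bounded-weaken (ℕₚ.m≤n+m _ _) (norm-bounded v)

bound : ∀ {b} → List (ℤ^ b) → ℕ
bound T = sum (map norm T)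

bound-bounded : ∀ {b} (T : List (ℤ^ b)) → All (Bounded (bound T)) T
bound-bounded [] = []
bound-bounded (y ∷ T) = bounded-weaken (ℕₚ.m≤m+n _ _) (norm-bounded y)
                      ∷ All.map (bounded-weaken (ℕₚ.m≤n+m _ _)) (bound-bounded T)

record Split {A : Set} (T : List A) : Set where
  constructor split
  field
    pre post : List A
    el : A
    is-split : T ≡ pre ++ el ∷ post

  rest : List A
  rest = pre ++ post

open Split

module _ {A : Set} {P : A → Set} where

  All-el : ∀ {T} (s : Split T) → All P T → P (el s)
  All-el (split pre _ _ refl) ps = All.head (proj₂ (++⁻ pre ps))

  All-rest : ∀ {T} (s : Split T) → All P T → All P (rest s)
  All-rest (split pre _ _ refl) ps with ++⁻ pre ps
  ... | ps-pre , _ ∷ ps-post = ++⁺ ps-pre ps-post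

Unique-el : ∀ {A : Set} {T : List A} (s : Split T) → Unique T → All (el s ≢_) (rest s)
Unique-el (split [] _ _ refl) (y≢ ∷ _) = y≢
Unique-el (split (a ∷ pre) post y refl) (a≢ ∷ u) =
  (λ y≡a → All-el (split pre post y refl) a≢ (sym y≡a)) ∷ Unique-el (split pre post y refl) u

sum-split : ∀ {A : Set} {T : List A} (h : A → ℤ) (s : Split T) →
  sumℤ (map h T) ≡ h (el s) + sumℤ (map h (rest s))
sum-split h (split [] _ _ refl) = refl
sum-split h (split (a ∷ pre) post y refl) = begin
  h a + sumℤ (map h (pre ++ y ∷ post))      ≡⟨ cong (_+_ (h a)) (sum-split h (split pre post y refl)) ⟩
  h a + (h y + sumℤ (map h (pre ++ post)))  ≡⟨ swap (h a) (h y) _ ⟩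
  h y + (h a + sumℤ (map h (pre ++ post)))  ∎
  where
  open ≡-Reasoning
  swap : ∀ a b c → a + (b + c) ≡ b + (a + c)
  swap = solve-∀

argmin : ∀ {A : Set} (φ : A → ℤ) (T : List A) → T ≢ [] →
  Σ (Split T) λ s → All (λ w → φ (el s) ≤ φ w) T
argmin φ [] nonempty = ⊥-elim (nonempty refl)
argmin φ (a ∷ []) _ = split [] [] a refl , ℤₚ.≤-refl ∷ []
argmin φ (a ∷ T@(_ ∷ _)) _ with argmin φ T (λ ())
... | split pre post y eq , y-min with φ a ℤₚ.≤? φ y
...   | yes a≤y = split [] T a refl , ℤₚ.≤-refl ∷ All.map (ℤₚ.≤-trans a≤y) y-min
...   | no a≰y  = split (a ∷ pre) post y (cong (a ∷_) eq) , ℤₚ.<⇒≤ (ℤₚ.≰⇒> a≰y) ∷ y-min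

strict-argmin : ∀ {A : Set} (φ : A → ℤ) (P : A → Set) →
  (∀ {u v} → P u → P v → φ u ≡ φ v → u ≡ v) →
  ∀ {T} → All P T → Unique T → T ≢ [] →
  Σ (Split T) λ s → All (λ w → φ (el s) ≤ φ w) T × All (λ w → φ (el s) < φ w) (rest s)
strict-argmin φ P injective {T} Ps unique nonempty = s , s-min , s-strict
  where
  s = proj₁ (argmin φ T nonempty)
  s-min = proj₂ (argmin φ T nonempty)
  s-strict : All (λ w → φ (el s) < φ w) (rest s)
  s-strict = All.zipWith
    (λ ((le , Pw) , el≢w) → ℤₚ.≤∧≢⇒< le (λ eq → el≢w (injective (All-el s Ps) Pw eq)))
    (All.zip (All-rest s s-min , All-rest s Ps) , Unique-el s unique)

record Extremes {A : Set} (φ : A → ℤ) (T : List A) : Set where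
  field
    low high : Split T
    low≤high : φ (el low) ≤ φ (el high)
    above-low : All (λ y → φ (el low) < φ y × φ y ≤ φ (el high)) (rest low)
    below-high : All (λ y → φ (el low) ≤ φ y × φ y < φ (el high)) (rest high)

extremes : ∀ {A : Set} (φ : A → ℤ) (P : A → Set) →
  (∀ {u v} → P u → P v → φ u ≡ φ v → u ≡ v) →
  ∀ {T} → All P T → Unique T → T ≢ [] → Extremes φ T
extremes φ P injective Ps unique nonempty = record
  { low = low
  ; high = high
  ; low≤high = All-el high low-min
  ; above-low = All.zip (low-strict , All-rest low high-max)
  ; below-high = All.zip (All-rest high low-min , high-strict)
  }
  where
  minimum = strict-argmin φ P injective Ps unique nonempty
  maximum = strict-argmin (λ w → - φ w) P
              (λ Pu Pv eq → injective Pu Pv (ℤₚ.neg-injective eq)) Ps unique nonempty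
  low = proj₁ minimum
  high = proj₁ maximum
  low-min = proj₁ (proj₂ minimum)
  low-strict = proj₂ (proj₂ minimum)
  high-max = All.map ℤₚ.neg-cancel-≤ (proj₁ (proj₂ maximum))
  high-strict = All.map ℤₚ.neg-cancel-< (proj₂ (proj₂ maximum))

reduce : ∀ t .{{_ : ℕ.NonZero t}} → ℤ → Fin t
reduce t a = fromℕ< (n%ℕd<d a t)

reduce-completes : ∀ t .{{_ : ℕ.NonZero t}} (F S : ℤ) →
  (+ toℕ (reduce t (F - S)) + S) ≡ F [mod t ]
reduce-completes t F S = divides ∣ - q ∣ (begin
    ∣ + r + S - F ∣          ≡⟨ cong ∣_∣ offset ⟩
    ∣ - q * + t ∣            ≡⟨ ℤₚ.abs-* (- q) (+ t) ⟩
    ∣ - q ∣ ℕ.* t            ∎)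
  where
  open ≡-Reasoning
  A = F - S
  r = toℕ (reduce t A)
  q = A /ℕ t
  regroup : ∀ r S F q t → r + S - F ≡ - q * t + (r + q * t - (F - S))
  regroup = solve-∀
  offset : + r + S - F ≡ - q * + t
  offset = begin
    + r + S - F                              ≡⟨ cong (λ u → + u + S - F) (toℕ-fromℕ< (n%ℕd<d A t)) ⟩
    + (A %ℕ t) + S - F                       ≡⟨ regroup (+ (A %ℕ t)) S F q (+ t) ⟩
    - q * + t + (+ (A %ℕ t) + q * + t - A)   ≡⟨ cong (λ u → - q * + t + (u - A)) (sym (a≡a%ℕn+[a/ℕn]*n A t)) ⟩
    - q * + t + (A - A)                      ≡⟨ cong (_+_ (- q * + t)) (ℤₚ.+-inverseʳ A) ⟩
    - q * + t + + 0                          ≡⟨ ℤₚ.+-identityʳ _ ⟩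
    - q * + t                                ∎

-- The value h(x - y) that makes the congruence at x hold, when the other
-- summands are those over S.
complete : ∀ {b t} .{{_ : ℕ.NonZero t}} → (ℤ^ b → ℤ) → (ℤ^ b → Fin t) →
  List (ℤ^ b) → ℤ^ b → Fin t
complete {t = t} f h S x = reduce t (f x - convSum h S x)

complete-sound : ∀ {b t} .{{_ : ℕ.NonZero t}} (f : ℤ^ b → ℤ) (h : ℤ^ b → Fin t)
  {T} (s : Split T) {x} → h (x ⊖ el s) ≡ complete f h (rest s) x →
  convSum h T x ≡ f x [mod t ]
complete-sound {t = t} f h s {x} chosen =
  subst (λ u → u ≡ f x [mod t ])
    (sym (trans (sum-split (λ y → + toℕ (h (x ⊖ y))) s)
                (cong (λ v → + toℕ v + convSum h (rest s) x) chosen)))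
    (reduce-completes t (f x) (convSum h (rest s) x))

complete-cong : ∀ {b t} .{{_ : ℕ.NonZero t}} (f : ℤ^ b → ℤ) {h h′ : ℤ^ b → Fin t} {S x} →
  All (λ y → h (x ⊖ y) ≡ h′ (x ⊖ y)) S → complete f h S x ≡ complete f h′ S x
complete-cong {t = t} f {h} {h′} {x = x} agree =
  cong (λ u → reduce t (f x - u)) (convSum-cong agree)
  where
  convSum-cong : ∀ {S} → All (λ y → h (x ⊖ y) ≡ h′ (x ⊖ y)) S → convSum h S x ≡ convSum h′ S x
  convSum-cong [] = refl
  convSum-cong (e ∷ es) = cong₂ _+_ (cong (λ v → + toℕ v) e) (convSum-cong es)

-- A fixpoint of a functional step whose value at z depends only on the
-- argument at points of smaller rank, obtained as the stable value of the
-- iterates of step starting from an arbitrary h₀.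
module GuardedFixpoint {X A : Set} (rank : X → ℕ) (step : (X → A) → X → A)
  (guarded : ∀ h h′ z → (∀ w → rank w ℕ.< rank z → h w ≡ h′ w) → step h z ≡ step h′ z)
  (h₀ : X → A) where

  iterate : ℕ → X → A
  iterate zero = h₀
  iterate (suc n) = step (iterate n)

  fix : X → A
  fix z = iterate (suc (rank z)) z

  iterate-stable : ∀ n z → rank z ℕ.≤ n → iterate (suc (suc n)) z ≡ iterate (suc n) z
  iterate-stable zero z rank≤0 =
    guarded _ _ z (λ w w<z → ⊥-elim (ℕₚ.n≮0 (ℕₚ.<-≤-trans w<z rank≤0)))
  iterate-stable (suc n) z rank≤n =
    guarded _ _ z (λ w w<z → iterate-stable n w (ℕₚ.≤-pred (ℕₚ.<-≤-trans w<z rank≤n)))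

  iterate-settled : ∀ {n z} → rank z ≤′ n → iterate (suc n) z ≡ fix z
  iterate-settled ≤′-refl = refl
  iterate-settled {suc n} {z} (≤′-step rank≤n) =
    trans (iterate-stable n z (ℕₚ.≤′⇒≤ rank≤n)) (iterate-settled rank≤n)

  settled-below : ∀ {n w} → rank w ℕ.< n → iterate n w ≡ fix w
  settled-below {suc n} (s≤s rank≤n) = iterate-settled (ℕₚ.≤⇒≤′ rank≤n)

  fix-unfold : ∀ z → fix z ≡ step fix z
  fix-unfold z = guarded _ _ z (λ w → settled-below)

-- How far the height j lies from the window [0, D).
distance : ℕ → ℤ → ℕ
distance D (+ n) = suc n ℕ.∸ D
distance D -[1+ n ] = suc n

distance-up : ∀ {D i j} → + D ≤ j → + 0 ≤ i → i < j → distance D i ℕ.< distance D j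
distance-up {D} {+ m} {+ n} (+≤+ D≤n) _ (+<+ m<n) = begin-strict
  suc m ℕ.∸ D     ≤⟨ ℕₚ.∸-monoˡ-≤ D m<n ⟩
  n ℕ.∸ D         <⟨ ℕₚ.n<1+n _ ⟩
  suc (n ℕ.∸ D)   ≡⟨ ℕₚ.+-∸-assoc 1 D≤n ⟨
  suc n ℕ.∸ D     ∎
  where open ℕₚ.≤-Reasoning

distance-down : ∀ {D i j} → j < + 0 → j < i → i < + D → distance D i ℕ.< distance D j
distance-down { i = -[1+ m ]} { -[1+ n ]} _ (-<- m<n) _ = s≤s m<n
distance-down { i = + m} { -[1+ n ]} _ _ (+<+ m<D) rewrite ℕₚ.m≤n⇒m∸n≡0 m<D = s≤s z≤n
distance-down {j = + _} (+<+ ()) _ _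

-- For φ z = j ≥ D and y ≠ y₁ in T, the point (z + y₁) - y has height
-- w = j + (a - c) with a - c ∈ [-D, 0), hence w ∈ [0, j).
descend-from-above : ∀ {D j w a c} → w + c ≡ j + a → a < c → c ≤ a + + D → + D ≤ j →
  + 0 ≤ w × w < j
descend-from-above {D} {j} {w} {a} {c} eq a<c c≤a+D D≤j =
  +-cancelʳ-≤ c (begin
    + 0 + c  ≡⟨ ℤₚ.+-identityˡ c ⟩
    c        ≤⟨ c≤a+D ⟩
    a + + D  ≤⟨ ℤₚ.+-monoʳ-≤ a D≤j ⟩
    a + j    ≡⟨ ℤₚ.+-comm a j ⟩
    j + a    ≡⟨ eq ⟨
    w + c    ∎) ,
  +-cancelʳ-< c (begin-strict
    w + c    ≡⟨ eq ⟩
    j + a    <⟨ ℤₚ.+-monoʳ-< j a<c ⟩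
    j + c    ∎)
  where open ℤₚ.≤-Reasoning

-- For φ z = j < 0 and y ≠ y₂ in T, the point (z + y₂) - y has height
-- w = j + (e - c) with e - c ∈ (0, D], hence w ∈ (j, D).
descend-from-below : ∀ {D j w a c e} → w + c ≡ j + e → a ≤ c → c < e → e ≡ a + + D → j < + 0 →
  j < w × w < + D
descend-from-below {D} {j} {w} {a} {c} {e} eq a≤c c<e e≡a+D j<0 =
  +-cancelʳ-< c (begin-strict
    j + c    <⟨ ℤₚ.+-monoʳ-< j c<e ⟩
    j + e    ≡⟨ eq ⟨
    w + c    ∎) ,
  +-cancelʳ-< c (begin-strict
    w + c    ≡⟨ eq ⟩
    j + e    <⟨ ℤₚ.+-monoˡ-< e j<0 ⟩
    + 0 + e  ≡⟨ ℤₚ.+-identityˡ e ⟩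
    e        ≡⟨ e≡a+D ⟩
    a + + D  ≤⟨ ℤₚ.+-monoˡ-≤ (+ D) a≤c ⟩
    c + + D  ≡⟨ ℤₚ.+-comm c (+ D) ⟩
    + D + c  ∎)
  where open ℤₚ.≤-Reasoning

-- If x - y₁ lies below height D then x - y₂ lies below height 0.
below-window : ∀ {D v w a e} → w + e ≡ v + a → v < + D → e ≡ a + + D → w < + 0
below-window {D} {v} {w} {a} {e} eq v<D e≡a+D = +-cancelʳ-< e (begin-strict
  w + e      ≡⟨ eq ⟩
  v + a      <⟨ ℤₚ.+-monoˡ-< a v<D ⟩
  + D + a    ≡⟨ ℤₚ.+-comm (+ D) a ⟩
  a + + D    ≡⟨ e≡a+D ⟨
  e          ≡⟨ ℤₚ.+-identityˡ e ⟨
  + 0 + e    ∎)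
  where open ℤₚ.≤-Reasoning

module Construction {t b : ℕ} .{{_ : ℕ.NonZero t}} (f : ℤ^ b → ℤ) (φ : ℤ^ b → ℤ)
  (φ-⊖ : ∀ x y → φ (x ⊖ y) ≡ φ x - φ y) (φ-⊕ : ∀ x y → φ (x ⊕ y) ≡ φ x + φ y)
  {T : List (ℤ^ b)} (E : Extremes φ T) where

  open Extremes E

  y₁ y₂ : ℤ^ b
  y₁ = el low
  y₂ = el high

  D : ℕ
  D = ∣ φ y₁ - φ y₂ ∣

  width : φ y₂ ≡ φ y₁ + + D
  width = trans (regroup (φ y₂) (φ y₁)) (cong (_+_ (φ y₁)) (sym (ℤₚ.∣-∣-≤ low≤high)))
    where
    regroup : ∀ e a → e ≡ a + (e - a)
    regroup = solve-∀

  height-of-difference : ∀ x y → φ (x ⊖ y) + φ y ≡ φ x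
  height-of-difference x y = trans (cong (_+ φ y) (φ-⊖ x y)) (cancel (φ x) (φ y))
    where
    cancel : ∀ p q → p - q + q ≡ p
    cancel = solve-∀

  -- Height of the point (z + y₀) - y whose value enters the congruence at z + y₀.
  translate : ∀ z y₀ y → φ ((z ⊕ y₀) ⊖ y) + φ y ≡ φ z + φ y₀
  translate z y₀ y = trans (height-of-difference (z ⊕ y₀) y) (φ-⊕ z y₀)

  rank : ℤ^ b → ℕ
  rank z = distance D (φ z)

  𝟘 : Fin t
  𝟘 = reduce t (+ 0)

  step : (ℤ^ b → Fin t) → ℤ^ b → Fin t
  step h z with φ z ℤₚ.<? + 0 | φ z ℤₚ.<? + D
  ... | yes _ | _     = complete f h (rest high) (z ⊕ y₂)
  ... | no _  | yes _ = 𝟘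
  ... | no _  | no _  = complete f h (rest low) (z ⊕ y₁)

  step-above : ∀ h z → ¬ φ z < + D → step h z ≡ complete f h (rest low) (z ⊕ y₁)
  step-above h z above with φ z ℤₚ.<? + 0 | φ z ℤₚ.<? + D
  ... | yes below | _     = ⊥-elim (above (ℤₚ.<-≤-trans below (+≤+ z≤n)))
  ... | no _      | yes inside = ⊥-elim (above inside)
  ... | no _      | no _  = refl

  step-below : ∀ h z → φ z < + 0 → step h z ≡ complete f h (rest high) (z ⊕ y₂)
  step-below h z below with φ z ℤₚ.<? + 0
  ... | yes _ = refl
  ... | no not-below = ⊥-elim (not-below below)

  rank-up : ∀ z → ¬ φ z < + D → ∀ {y} → φ y₁ < φ y × φ y ≤ φ y₂ →
    rank ((z ⊕ y₁) ⊖ y) ℕ.< rank z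
  rank-up z above {y} (y₁<y , y≤y₂) = distance-up D≤z nonneg lower
    where
    D≤z = ℤₚ.≮⇒≥ above
    moved = descend-from-above {w = φ ((z ⊕ y₁) ⊖ y)}
              (translate z y₁ y) y₁<y (subst (φ y ≤_) width y≤y₂) D≤z
    nonneg = proj₁ moved
    lower = proj₂ moved

  rank-down : ∀ z → φ z < + 0 → ∀ {y} → φ y₁ ≤ φ y × φ y < φ y₂ →
    rank ((z ⊕ y₂) ⊖ y) ℕ.< rank z
  rank-down z below {y} (y₁≤y , y<y₂) =
    distance-down below (proj₁ moved) (proj₂ moved)
    where
    moved = descend-from-below {w = φ ((z ⊕ y₂) ⊖ y)}
              (translate z y₂ y) y₁≤y y<y₂ width below

  step-guarded : ∀ h h′ z → (∀ w → rank w ℕ.< rank z → h w ≡ h′ w) → step h z ≡ step h′ z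
  step-guarded h h′ z agree with φ z ℤₚ.<? + 0 | φ z ℤₚ.<? + D
  ... | yes below | _        =
    complete-cong f {h} {h′} (All.map (λ bds → agree _ (rank-down z below bds)) below-high)
  ... | no _      | yes _    = refl
  ... | no _      | no above =
    complete-cong f {h} {h′} (All.map (λ bds → agree _ (rank-up z above bds)) above-low)

  open GuardedFixpoint rank step step-guarded (λ _ → 𝟘) using (fix; fix-unfold)

  solution : ℤ^ b → Fin t
  solution = fix

  -- The congruence at x was imposed when g(x - el s) was chosen via s.
  imposed : ∀ (s : Split T) x →
    step fix (x ⊖ el s) ≡ complete f fix (rest s) ((x ⊖ el s) ⊕ el s) →
    convSum fix T x ≡ f x [mod t ]
  imposed s x chosen = complete-sound f fix s (begin
    fix (x ⊖ el s)                                       ≡⟨ fix-unfold (x ⊖ el s) ⟩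
    step fix (x ⊖ el s)                                  ≡⟨ chosen ⟩
    complete f fix (rest s) ((x ⊖ el s) ⊕ el s)          ≡⟨ cong (complete f fix (rest s)) (⊖-⊕-cancel x (el s)) ⟩
    complete f fix (rest s) x                            ∎)
    where open ≡-Reasoning

  solves : ∀ x → convSum solution T x ≡ f x [mod t ]
  solves x with φ (x ⊖ y₁) ℤₚ.<? + D
  ... | no above = imposed low x (step-above fix (x ⊖ y₁) above)
  ... | yes below = imposed high x (step-below fix (x ⊖ y₂) (below-window same-x below width))
    where
    same-x : φ (x ⊖ y₂) + φ y₂ ≡ φ (x ⊖ y₁) + φ y₁
    same-x = trans (height-of-difference x y₂) (sym (height-of-difference x y₁))

proposition14 : (t b : ℕ) → t ≥ 1 → (T : List (ℤ^ b)) → Unique T → T ≢ [] →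
    (f : ℤ^ b → ℤ) →
    Σ (ℤ^ b → Fin t) (λ g → (x : ℤ^ b) → convSum g T x ≡ f x [mod t ])
proposition14 zero _ () _ _ _ _
proposition14 t@(suc _) b _ T unique nonempty f = solution , solves
  where
  B : ℕ
  B = bound T
  φ : ℤ^ b → ℤ
  φ = height (suc (B ℕ.+ B))
  open Construction {t = t} f φ (height-⊖ _) (height-⊕ _)
    (extremes φ (Bounded B) (height-injective B) (bound-bounded T) unique nonempty)
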